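{- Let $\Gamma$ be a restricted-normal digraph of order $n$ with adjacency matrix $A$. For $k\ge1$, the digraph $\hat\Gamma$ with adjacency matrix $A\otimes J_k$ is a restricted-normal digraph of order $nk$. Furthermore, $\hat\Gamma$ is a directed join if and only if $\Gamma$ is a directed join.
   Context: Digraphs are finite, simple (no loops) and unweighted. $J_k$ is the $k\times k$ all-ones matrix and $\otimes$ is the Kronecker product. The Laplacian of a digraph is $L=D-A$ with $D$ the diagonal matrix of out-degrees. $\mathbf{e}$ is the all-ones vector; a restrictor matrix of order $N$ is an $N\times(N-1)$ matrix $Q$ with orthonormal columns orthogonal to $\mathbf{e}$. A digraph is restricted-normal if $L$ is not normal but $Q^*LQ$ is normal (independent of the choice of $Q$). A digraph $(V,E)$ is a directed join if there is a partition $V=V_1\sqcup V_2$ into nonempty sets such that $(i,j)\in E$ for all $i\in V_1,j\in V_2$ and there is no edge $(j,i)\in E$ with $j\in V_2,i\in V_1$. -}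

module Defs where

open import Level using (Level; _⊔_) renaming (suc to lsuc)
open import Data.Nat using (ℕ; zero; suc; _∸_) renaming (_*_ to _ℕ*_)
open import Data.Fin using (Fin; zero; suc; _≟_; remQuot)
open import Data.Bool using (Bool; true; false; _∧_; if_then_else_)
open import Data.Product using (Σ; _×_; _,_; ∃; ∃-syntax; proj₁; proj₂)
open import Relation.Nullary using (¬_; does)
open import Relation.Binary.PropositionalEquality using (_≡_; refl)
open import Relation.Binary.Core using (Rel)
open import Relation.Binary.Structures using (IsTotalOrder)
open import Algebra.Bundles using (CommutativeRing)

-- The agda-stdlib has no real numbers, so the scalar field is
-- an arbitrary ordered Euclidean field (ordered field in which every
-- non-negative element has a square root); ℝ is such a field.

record EuclideanField (c ℓ ℓ' : Level) : Set (lsuc (c ⊔ ℓ ⊔ ℓ')) where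
  field
    commutativeRing : CommutativeRing c ℓ
  open CommutativeRing commutativeRing public
  field
    _≤_         : Rel Carrier ℓ'
    isTotalOrder : IsTotalOrder _≈_ _≤_
    +-mono-≤    : ∀ {x y} z → x ≤ y → (x + z) ≤ (y + z)
    *-nonneg    : ∀ {x y} → 0# ≤ x → 0# ≤ y → 0# ≤ (x * y)
    0≉1         : ¬ (0# ≈ 1#)
    inverse     : ∀ x → ¬ (x ≈ 0#) → ∃[ y ] (x * y ≈ 1#)
    sqrt        : ∀ x → 0# ≤ x → ∃[ y ] (y * y ≈ x)

BMat : ℕ → ℕ → Set
BMat m n = Fin m → Fin n → Bool

record Digraph (n : ℕ) : Set where
  field
    adj     : BMat n n
    loopless : ∀ i → adj i i ≡ false

open Digraph public

J : (k : ℕ) → BMat k k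
J k _ _ = true

-- Kronecker product of 0/1 matrices; index combine i a = i * q + a
-- (Data.Fin.combine / remQuot), the usual Kronecker convention.
_⊗_ : ∀ {m n p q} → BMat m n → BMat p q → BMat (m ℕ* p) (n ℕ* q)
_⊗_ {m} {n} {p} {q} A B x y =
  A (proj₁ (remQuot {m} p x)) (proj₁ (remQuot {n} q y)) ∧
  B (proj₂ (remQuot {m} p x)) (proj₂ (remQuot {n} q y))

∧true-false : ∀ {b} → b ≡ false → (b ∧ true) ≡ false
∧true-false refl = refl

blowup : ∀ {n} → Digraph n → (k : ℕ) → Digraph (n ℕ* k)
blowup {n} Γ k = record
  { adj = adj Γ ⊗ J k
  ; loopless = λ x → ∧true-false (loopless Γ (proj₁ (remQuot {n} k x))) }

DirectedJoin : ∀ {n} → Digraph n → Set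
DirectedJoin {n} Γ =
  Σ (Fin n → Bool) λ side →
    (∃[ i ] side i ≡ true) × (∃[ j ] side j ≡ false) ×
    (∀ i j → side i ≡ true → side j ≡ false → adj Γ i j ≡ true) ×
    (∀ j i → side j ≡ false → side i ≡ true → adj Γ j i ≡ false)

module Matrices {c ℓ ℓ'} (F : EuclideanField c ℓ ℓ') where
  open EuclideanField F using (Carrier; _≈_; _+_; _*_; _-_; 0#; 1#)

  Mat : ℕ → ℕ → Set c
  Mat m n = Fin m → Fin n → Carrier

  sumF : ∀ n → (Fin n → Carrier) → Carrier
  sumF zero    f = 0#
  sumF (suc n) f = f zero + sumF n (λ i → f (suc i))

  _⊠_ : ∀ {m n p} → Mat m n → Mat n p → Mat m p
  _⊠_ {n = n} A B i j = sumF n (λ l → A i l * B l j)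

  -- transpose (= conjugate transpose, entries being real)
  _ᵀ : ∀ {m n} → Mat m n → Mat n m
  (A ᵀ) i j = A j i

  _≋_ : ∀ {m n} → Mat m n → Mat m n → Set ℓ
  A ≋ B = ∀ i j → A i j ≈ B i j

  I : ∀ n → Mat n n
  I n i j = if does (i ≟ j) then 1# else 0#

  𝐞 : ∀ n → Mat n 1
  𝐞 n _ _ = 1#

  𝟎 : ∀ m n → Mat m n
  𝟎 m n _ _ = 0#

  fromBool : Bool → Carrier
  fromBool true  = 1#
  fromBool false = 0#

  adjacency : ∀ {n} → Digraph n → Mat n n
  adjacency Γ i j = fromBool (adj Γ i j)

  outdeg : ∀ {n} → Digraph n → Fin n → Carrier
  outdeg {n} Γ i = sumF n (λ j → adjacency Γ i j)

  laplacian : ∀ {n} → Digraph n → Mat n n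
  laplacian Γ i j = (if does (i ≟ j) then outdeg Γ i else 0#) - adjacency Γ i j

  Normal : ∀ {n} → Mat n n → Set ℓ
  Normal M = (M ⊠ (M ᵀ)) ≋ ((M ᵀ) ⊠ M)

  IsRestrictor : ∀ {N} → Mat N (N ∸ 1) → Set ℓ
  IsRestrictor {N} Q = (((Q ᵀ) ⊠ Q) ≋ I (N ∸ 1)) × (((Q ᵀ) ⊠ 𝐞 N) ≋ 𝟎 (N ∸ 1) 1)

  RestrictedNormal : ∀ {n} → Digraph n → Set (c ⊔ ℓ)
  RestrictedNormal {n} Γ =
    ¬ Normal (laplacian Γ) ×
    (∀ (Q : Mat n (n ∸ 1)) → IsRestrictor Q → Normal (((Q ᵀ) ⊠ laplacian Γ) ⊠ Q))

{-# OPTIONS --safe #-}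
-- Write L̂ for the Laplacian of the blow-up and x ↦ Σₐ x(i,a) for the block sums. Since
-- L̂ = kD ⊗ I − A ⊗ J, the form uᵀ(L̂L̂ᵀ − L̂ᵀL̂)v and the entry sum of L̂u depend only on the block
-- sums of u and v, up to the factor k. For a restrictor Q, normality of QᵀLQ says that the bilinear
-- form of LLᵀ − LᵀPL (P the projection onto e⊥) vanishes on the columns of Q, hence on all of e⊥;
-- block sums of vectors in e⊥ lie in e⊥, so restricted normality passes from Γ to Γ̂, and
-- non-normality of L transfers to L̂ through the standard basis. A directed join cannot separate
-- two vertices of the same block, which gives the second claim.
module Submission where

open import Level using (_⊔_)
open import Data.Nat as ℕ using (ℕ; zero; suc; _∸_)
open import Data.Integer as ℤ using (ℤ; +_; -[1+_])
import Data.Nat.Properties as ℕ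
import Data.Integer.Properties as ℤ
open import Data.Sign as Sign using (Sign)
open import Data.Fin as Fin using (Fin; zero; suc; combine; _↑ˡ_; _↑ʳ_)
open import Data.Bool using (true; false; if_then_else_)
open import Data.Bool.Properties using (∧-identityʳ)
open import Data.Fin.Properties using (remQuot-combine; combine-injectiveˡ; combine-injectiveʳ)
open import Function using (_∘_)
open import Function.Bundles using (_⇔_; mk⇔)
open import Data.Maybe using (Maybe; just; nothing)
open import Data.Product using (Σ; ∃₂; ∃-syntax; _×_; _,_; proj₁; proj₂)
open import Data.Sum using (inj₁; inj₂)
open import Data.Empty using (⊥-elim)
open import Relation.Nullary using (¬_; yes; no; does)
import Relation.Binary.PropositionalEquality as ≡
open import Relation.Binary.PropositionalEquality using (_≡_; _≢_)
open import Relation.Binary.Structures using (IsTotalOrder)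
import Algebra.Solver.Ring
open import Algebra.Solver.Ring.AlmostCommutativeRing
  using (fromCommutativeRing; _-Raw-AlmostCommutative⟶_)
open import Defs

quotient-combine : ∀ {n k} (i : Fin n) (a : Fin k) → Fin.quotient k (combine i a) ≡ i
quotient-combine {n} {k} i a = ≡.cong proj₁ (remQuot-combine {n} {k} i a)

module _ {n} (Γ : Digraph n) (k : ℕ) where

  blowup-adj : ∀ x y → adj (blowup Γ k) x y ≡ adj Γ (Fin.quotient k x) (Fin.quotient k y)
  blowup-adj x y = ∧-identityʳ _

  blowup-adj-combine : ∀ i a j b → adj (blowup Γ k) (combine i a) (combine j b) ≡ adj Γ i j
  blowup-adj-combine i a j b = ≡.trans (blowup-adj _ _) (≡.cong₂ (adj Γ) (quotient-combine i a) (quotient-combine j b))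

module _ {n k : ℕ} (Γ : Digraph n) where
  private
    Γ̂ = blowup Γ (suc k)
    block : Fin (n ℕ.* suc k) → Fin n
    block = Fin.quotient (suc k)
    representative : Fin n → Fin (n ℕ.* suc k)
    representative i = combine i zero

  directedJoin⇒blowup : DirectedJoin Γ → DirectedJoin Γ̂
  directedJoin⇒blowup (side , (i , i∈V₁) , (j , j∈V₂) , V₁→V₂ , ¬V₂→V₁) =
    (λ x → side (block x))
    , (representative i , ≡.trans (≡.cong side (quotient-combine i zero)) i∈V₁)
    , (representative j , ≡.trans (≡.cong side (quotient-combine j zero)) j∈V₂)
    , (λ x y x∈V₁ y∈V₂ → ≡.trans (blowup-adj Γ (suc k) x y) (V₁→V₂ (block x) (block y) x∈V₁ y∈V₂))
    , (λ y x y∈V₂ x∈V₁ → ≡.trans (blowup-adj Γ (suc k) y x) (¬V₂→V₁ (block y) (block x) y∈V₂ x∈V₁))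

  blowup⇒directedJoin : DirectedJoin Γ̂ → DirectedJoin Γ
  blowup⇒directedJoin (side , (x , x∈V₁) , (y , y∈V₂) , V₁→V₂ , ¬V₂→V₁) =
    side ∘ representative
    , (block x , ≡.trans (≡.sym (side-block x)) x∈V₁)
    , (block y , ≡.trans (≡.sym (side-block y)) y∈V₂)
    , (λ i j i∈V₁ j∈V₂ → ≡.trans (≡.sym (blowup-adj-combine Γ (suc k) i zero j zero)) (V₁→V₂ _ _ i∈V₁ j∈V₂))
    , (λ j i j∈V₂ i∈V₁ → ≡.trans (≡.sym (blowup-adj-combine Γ (suc k) j zero i zero)) (¬V₂→V₁ _ _ j∈V₂ i∈V₁))
    where
    no-edge : ∀ x y → block x ≡ block y → adj Γ̂ x y ≡ false
    no-edge x y bx≡by = ≡.trans (blowup-adj Γ (suc k) x y) (≡.trans (≡.cong (adj Γ (block x)) (≡.sym bx≡by)) (loopless Γ (block x)))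
    true≢false : true ≢ false
    true≢false ()
    -- a vertex and the representative of its block have no edge between them, so a directed join
    -- cannot separate them
    side-block : ∀ x → side x ≡ side (representative (block x))
    side-block x with side x in sx | side (representative (block x)) in sr
    ... | true  | true  = ≡.refl
    ... | false | false = ≡.refl
    ... | true  | false = ⊥-elim (true≢false (≡.trans (≡.sym (V₁→V₂ x _ sx sr)) (no-edge x _ (≡.sym (quotient-combine (block x) zero)))))
    ... | false | true  = ⊥-elim (true≢false (≡.trans (≡.sym (V₁→V₂ _ x sr sx)) (no-edge _ x (quotient-combine (block x) zero))))

  blowup-directedJoin⇔ : DirectedJoin Γ̂ ⇔ DirectedJoin Γ
  blowup-directedJoin⇔ = mk⇔ blowup⇒directedJoin directedJoin⇒blowup

module _ {c ℓ ℓ'} (F : EuclideanField c ℓ ℓ') where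
  open EuclideanField F hiding (zero)
  open Matrices F
  open import Relation.Binary.Reasoning.Setoid setoid
  open import Algebra.Properties.Ring ring
    using (-‿involutive; -0#≈0#; -‿distribˡ-*; -‿distribʳ-*)
  open import Algebra.Properties.AbelianGroup +-abelianGroup using (⁻¹-∙-comm)
  open import Algebra.Properties.CommutativeSemigroup +-commutativeSemigroup using (interchange)
  open import Algebra.Properties.CommutativeSemigroup *-commutativeSemigroup
    using () renaming (interchange to interchange*)
  open import Algebra.Properties.Semiring.Mult.TCOptimised semiring
    using (1+×; ×-homo-+; ×1-homo-*) renaming (_×_ to _×ᶜ_)
  module ≤ = IsTotalOrder isTotalOrder

  fromℕ : ℕ → Carrier
  fromℕ n = n ×ᶜ 1#

  fromℕ-suc : ∀ n → fromℕ (suc n) ≈ 1# + fromℕ n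
  fromℕ-suc n = 1+× n 1#

  -- Integer coefficients let the ring solver cancel terms (x - x ≈ 0), which it cannot do with
  -- coefficients in the abstract carrier.
  fromℤ : ℤ → Carrier
  fromℤ (+ n)    = fromℕ n
  fromℤ -[1+ n ] = - fromℕ (suc n)

  private
    signed : Sign → Carrier
    signed Sign.+ = 1#
    signed Sign.- = - 1#

    signed-* : ∀ s t → signed (s Sign.* t) ≈ signed s * signed t
    signed-* Sign.+ t      = sym (*-identityˡ _)
    signed-* Sign.- Sign.+ = sym (*-identityʳ _)
    signed-* Sign.- Sign.- = begin
      1#            ≈⟨ sym (-‿involutive 1#) ⟩
      - - 1#        ≈⟨ -‿cong (sym (*-identityʳ _)) ⟩
      - (- 1# * 1#) ≈⟨ -‿distribʳ-* (- 1#) 1# ⟩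
      - 1# * - 1#   ∎

    fromℤ-◃ : ∀ s n → fromℤ (s ℤ.◃ n) ≈ signed s * fromℕ n
    fromℤ-◃ s       zero    = sym (zeroʳ _)
    fromℤ-◃ Sign.+ (suc n) = sym (*-identityˡ _)
    fromℤ-◃ Sign.- (suc n) = trans (-‿cong (sym (*-identityˡ _))) (-‿distribˡ-* 1# _)

    fromℤ-signAbs : ∀ i → fromℤ i ≈ signed (ℤ.sign i) * fromℕ ℤ.∣ i ∣
    fromℤ-signAbs i = begin
      fromℤ i                               ≡⟨ ≡.cong fromℤ (≡.sym (ℤ.◃-inverse i)) ⟩
      fromℤ (ℤ.sign i ℤ.◃ ℤ.∣ i ∣)          ≈⟨ fromℤ-◃ (ℤ.sign i) ℤ.∣ i ∣ ⟩
      signed (ℤ.sign i) * fromℕ ℤ.∣ i ∣ ∎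

    fromℤ-⊖ : ∀ m n → fromℤ (m ℤ.⊖ n) ≈ fromℕ m - fromℕ n
    fromℤ-⊖ zero    zero    = sym (-‿inverseʳ 0#)
    fromℤ-⊖ zero    (suc n) = sym (+-identityˡ _)
    fromℤ-⊖ (suc m) zero    = sym (trans (+-congˡ -0#≈0#) (+-identityʳ _))
    fromℤ-⊖ (suc m) (suc n) = begin
      fromℤ (suc m ℤ.⊖ suc n)                ≡⟨ ≡.cong fromℤ (ℤ.[1+m]⊖[1+n]≡m⊖n m n) ⟩
      fromℤ (m ℤ.⊖ n)                        ≈⟨ fromℤ-⊖ m n ⟩
      fromℕ m - fromℕ n                      ≈⟨ -‿cancel-+ˡ 1# (fromℕ m) (fromℕ n) ⟩
      (1# + fromℕ m) - (1# + fromℕ n)        ≈⟨ sym (+-cong (fromℕ-suc m) (-‿cong (fromℕ-suc n))) ⟩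
      fromℕ (suc m) - fromℕ (suc n)          ∎
      where
      -‿cancel-+ˡ : ∀ z x y → x - y ≈ (z + x) - (z + y)
      -‿cancel-+ˡ z x y = sym (begin
        (z + x) - (z + y)   ≈⟨ +-congˡ (sym (⁻¹-∙-comm z y)) ⟩
        (z + x) + (- z - y) ≈⟨ interchange z x (- z) (- y) ⟩
        (z - z) + (x - y)   ≈⟨ +-congʳ (-‿inverseʳ z) ⟩
        0# + (x - y)        ≈⟨ +-identityˡ _ ⟩
        x - y               ∎)

    fromℤ-+ : ∀ i j → fromℤ (i ℤ.+ j) ≈ fromℤ i + fromℤ j
    fromℤ-+ -[1+ m ] -[1+ n ] = begin
      - fromℕ (suc (suc (m ℕ.+ n)))        ≡⟨ ≡.cong (λ z → - fromℕ (suc z)) (≡.sym (ℕ.+-suc m n)) ⟩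
      - fromℕ (suc m ℕ.+ suc n)            ≈⟨ -‿cong (×-homo-+ 1# (suc m) (suc n)) ⟩
      - (fromℕ (suc m) + fromℕ (suc n))    ≈⟨ sym (⁻¹-∙-comm _ _) ⟩
      - fromℕ (suc m) - fromℕ (suc n)      ∎
    fromℤ-+ -[1+ m ] (+ n)    = trans (fromℤ-⊖ n (suc m)) (+-comm _ _)
    fromℤ-+ (+ m)    -[1+ n ] = fromℤ-⊖ m (suc n)
    fromℤ-+ (+ m)    (+ n)    = ×-homo-+ 1# m n

    fromℤ-* : ∀ i j → fromℤ (i ℤ.* j) ≈ fromℤ i * fromℤ j
    fromℤ-* i j = begin
      fromℤ (i ℤ.* j)                          ≈⟨ fromℤ-◃ (s Sign.* t) (∣i∣ ℕ.* ∣j∣) ⟩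
      signed (s Sign.* t) * fromℕ (∣i∣ ℕ.* ∣j∣)  ≈⟨ *-cong (signed-* s t) (×1-homo-* ∣i∣ ∣j∣) ⟩
      (signed s * signed t) * (fromℕ ∣i∣ * fromℕ ∣j∣) ≈⟨ interchange* _ _ _ _ ⟩
      (signed s * fromℕ ∣i∣) * (signed t * fromℕ ∣j∣) ≈⟨ sym (*-cong (fromℤ-signAbs i) (fromℤ-signAbs j)) ⟩
      fromℤ i * fromℤ j                        ∎
      where
      s = ℤ.sign i
      t = ℤ.sign j
      ∣i∣ = ℤ.∣ i ∣
      ∣j∣ = ℤ.∣ j ∣

    fromℤ-neg : ∀ i → fromℤ (ℤ.- i) ≈ - fromℤ i
    fromℤ-neg -[1+ n ]     = sym (-‿involutive _)
    fromℤ-neg (+ zero)     = sym -0#≈0#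
    fromℤ-neg (+ (suc n))  = refl

    fromℤ-morphism : ℤ.+-*-rawRing -Raw-AlmostCommutative⟶ fromCommutativeRing commutativeRing
    fromℤ-morphism = record
      { ⟦_⟧    = fromℤ
      ; +-homo = fromℤ-+
      ; *-homo = fromℤ-*
      ; -‿homo = fromℤ-neg
      ; 0-homo = refl
      ; 1-homo = refl
      }

    fromℤ-≟ : ∀ i j → Maybe (fromℤ i ≈ fromℤ j)
    fromℤ-≟ i j with i ℤ.≟ j
    ... | yes i≡j = just (reflexive (≡.cong fromℤ i≡j))
    ... | no _    = nothing

  open Algebra.Solver.Ring ℤ.+-*-rawRing (fromCommutativeRing commutativeRing) fromℤ-morphism fromℤ-≟
    using (solve; _:=_; _:+_; _:*_; :-_; _:-_; con)

  x-y≈0⇒x≈y : ∀ {x y} → x - y ≈ 0# → x ≈ y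
  x-y≈0⇒x≈y {x} {y} x-y≈0 = begin
    x             ≈⟨ solve 2 (λ x y → x := (x :- y) :+ y) refl x y ⟩
    (x - y) + y   ≈⟨ +-congʳ x-y≈0 ⟩
    0# + y        ≈⟨ +-identityˡ y ⟩
    y             ∎

  x≈y⇒x-y≈0 : ∀ {x y} → x ≈ y → x - y ≈ 0#
  x≈y⇒x-y≈0 {y = y} x≈y = trans (+-congʳ x≈y) (-‿inverseʳ y)

  ≤-resp-≈ : ∀ {x x' y y'} → x ≈ x' → y ≈ y' → x ≤ y → x' ≤ y'
  ≤-resp-≈ x≈x' y≈y' x≤y = ≤.≤-respʳ-≈ y≈y' (≤.≤-respˡ-≈ x≈x' x≤y)

  x≤0⇒0≤-x : ∀ {x} → x ≤ 0# → 0# ≤ (- x)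
  x≤0⇒0≤-x {x} x≤0 = ≤-resp-≈ (-‿inverseʳ x) (+-identityˡ (- x)) (+-mono-≤ (- x) x≤0)

  0≤1 : 0# ≤ 1#
  0≤1 with ≤.total 0# 1#
  ... | inj₁ 0≤1′ = 0≤1′
  ... | inj₂ 1≤0 = ≤-resp-≈ refl (solve 0 (:- con (+ 1) :* :- con (+ 1) := con (+ 1)) refl) (*-nonneg 0≤-1 0≤-1)
    where
    0≤-1 : 0# ≤ (- 1#)
    0≤-1 = x≤0⇒0≤-x 1≤0

  1+x≉0 : ∀ {x} → 0# ≤ x → ¬ (1# + x ≈ 0#)
  1+x≉0 {x} 0≤x 1+x≈0 = 0≉1 (≤.antisym 0≤1 (≤-resp-≈ (+-identityˡ 1#) (trans (+-comm x 1#) 1+x≈0) (+-mono-≤ 1# 0≤x)))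

  fromℕ-nonneg : ∀ n → 0# ≤ fromℕ n
  fromℕ-nonneg zero    = ≤.refl
  fromℕ-nonneg (suc n) = ≤.trans 0≤1 (≤-resp-≈ (+-identityˡ 1#) (trans (+-comm _ 1#) (sym (fromℕ-suc n))) (+-mono-≤ 1# (fromℕ-nonneg n)))

  fromℕ-suc≉0 : ∀ n → ¬ (fromℕ (suc n) ≈ 0#)
  fromℕ-suc≉0 n eq = 1+x≉0 (fromℕ-nonneg n) (trans (sym (fromℕ-suc n)) eq)

  x*y≈0⇒y≈0 : ∀ {x y} → ¬ (x ≈ 0#) → x * y ≈ 0# → y ≈ 0#
  x*y≈0⇒y≈0 {x} {y} x≉0 xy≈0 = begin
    y                 ≈⟨ sym (*-identityˡ y) ⟩
    1# * y            ≈⟨ *-congʳ (sym (proj₂ (inverse x x≉0))) ⟩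
    (x * x⁻¹) * y     ≈⟨ solve 3 (λ x x⁻¹ y → (x :* x⁻¹) :* y := x⁻¹ :* (x :* y)) refl x x⁻¹ y ⟩
    x⁻¹ * (x * y)     ≈⟨ *-congˡ xy≈0 ⟩
    x⁻¹ * 0#          ≈⟨ zeroʳ x⁻¹ ⟩
    0#                ∎
    where
    x⁻¹ = proj₁ (inverse x x≉0)

  inverse-unique : ∀ {x y z} → x * y ≈ 1# → x * z ≈ 1# → y ≈ z
  inverse-unique {x} {y} {z} xy≈1 xz≈1 = begin
    y             ≈⟨ sym (*-identityʳ y) ⟩
    y * 1#        ≈⟨ *-congˡ (sym xz≈1) ⟩
    y * (x * z)   ≈⟨ solve 3 (λ x y z → y :* (x :* z) := (x :* y) :* z) refl x y z ⟩
    (x * y) * z   ≈⟨ *-congʳ xy≈1 ⟩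
    1# * z        ≈⟨ *-identityˡ z ⟩
    z             ∎

  inverseSqrt : ∀ n → ∃[ a ] fromℕ (suc n) * (a * a) ≈ 1#
  inverseSqrt n = r⁻¹ , (begin
    fromℕ (suc n) * (r⁻¹ * r⁻¹)  ≈⟨ *-congʳ (sym r*r≈n) ⟩
    (r * r) * (r⁻¹ * r⁻¹)        ≈⟨ interchange* r r r⁻¹ r⁻¹ ⟩
    (r * r⁻¹) * (r * r⁻¹)        ≈⟨ *-cong r*r⁻¹≈1 r*r⁻¹≈1 ⟩
    1# * 1#                      ≈⟨ *-identityˡ 1# ⟩
    1#                           ∎)
    where
    r = proj₁ (sqrt (fromℕ (suc n)) (fromℕ-nonneg (suc n)))
    r*r≈n : r * r ≈ fromℕ (suc n)
    r*r≈n = proj₂ (sqrt (fromℕ (suc n)) (fromℕ-nonneg (suc n)))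
    r≉0 : ¬ (r ≈ 0#)
    r≉0 r≈0 = fromℕ-suc≉0 n (trans (sym r*r≈n) (trans (*-congʳ r≈0) (zeroˡ r)))
    r⁻¹ = proj₁ (inverse r r≉0)
    r*r⁻¹≈1 : r * r⁻¹ ≈ 1#
    r*r⁻¹≈1 = proj₂ (inverse r r≉0)

  1/suc : ℕ → Carrier
  1/suc n = proj₁ (inverse (fromℕ (suc n)) (fromℕ-suc≉0 n))

  *-1/suc : ∀ n → fromℕ (suc n) * 1/suc n ≈ 1#
  *-1/suc n = proj₂ (inverse (fromℕ (suc n)) (fromℕ-suc≉0 n))

  Vector : ℕ → Set c
  Vector n = Fin n → Carrier

  sumF-cong : ∀ n {f g : Vector n} → (∀ i → f i ≈ g i) → sumF n f ≈ sumF n g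
  sumF-cong zero    f≈g = refl
  sumF-cong (suc n) f≈g = +-cong (f≈g zero) (sumF-cong n (λ i → f≈g (suc i)))

  sumF-0# : ∀ n → sumF n (λ _ → 0#) ≈ 0#
  sumF-0# zero    = refl
  sumF-0# (suc n) = trans (+-identityˡ _) (sumF-0# n)

  sumF-+ : ∀ n (f g : Vector n) → sumF n (λ i → f i + g i) ≈ sumF n f + sumF n g
  sumF-+ zero    f g = sym (+-identityˡ 0#)
  sumF-+ (suc n) f g = trans (+-congˡ (sumF-+ n _ _)) (interchange _ _ _ _)

  sumF-neg : ∀ n (f : Vector n) → sumF n (λ i → - f i) ≈ - sumF n f
  sumF-neg zero    f = sym -0#≈0#
  sumF-neg (suc n) f = trans (+-congˡ (sumF-neg n _)) (⁻¹-∙-comm _ _)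

  sumF-sub : ∀ n (f g : Vector n) → sumF n (λ i → f i - g i) ≈ sumF n f - sumF n g
  sumF-sub n f g = trans (sumF-+ n f (λ i → - g i)) (+-congˡ (sumF-neg n g))

  sumF-*ˡ : ∀ n a (f : Vector n) → sumF n (λ i → a * f i) ≈ a * sumF n f
  sumF-*ˡ zero    a f = sym (zeroʳ a)
  sumF-*ˡ (suc n) a f = trans (+-congˡ (sumF-*ˡ n a _)) (sym (distribˡ _ _ _))

  sumF-*ʳ : ∀ n (f : Vector n) a → sumF n (λ i → f i * a) ≈ sumF n f * a
  sumF-*ʳ n f a = trans (sumF-cong n (λ i → *-comm (f i) a)) (trans (sumF-*ˡ n a f) (*-comm _ _))

  sumF-const : ∀ n a → sumF n (λ _ → a) ≈ fromℕ n * a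
  sumF-const zero    a = sym (zeroˡ a)
  sumF-const (suc n) a = begin
    a + sumF n (λ _ → a)     ≈⟨ +-cong (sym (*-identityˡ a)) (sumF-const n a) ⟩
    1# * a + fromℕ n * a     ≈⟨ sym (distribʳ a 1# (fromℕ n)) ⟩
    (1# + fromℕ n) * a       ≈⟨ *-congʳ (sym (fromℕ-suc n)) ⟩
    fromℕ (suc n) * a        ∎

  sumF-swap : ∀ n m (f : Fin n → Fin m → Carrier) →
    sumF n (λ i → sumF m (f i)) ≈ sumF m (λ j → sumF n (λ i → f i j))
  sumF-swap zero    m f = sym (sumF-0# m)
  sumF-swap (suc n) m f = trans (+-congˡ (sumF-swap n m _)) (sym (sumF-+ m _ _))

  I-diag : ∀ {n} (i : Fin n) → I n i i ≈ 1#
  I-diag zero    = refl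
  I-diag (suc i) = I-diag i

  I-offdiag : ∀ {n} {i j : Fin n} → i ≢ j → I n i j ≈ 0#
  I-offdiag {i = zero}  {zero}  i≢j = ⊥-elim (i≢j ≡.refl)
  I-offdiag {i = zero}  {suc j} i≢j = refl
  I-offdiag {i = suc i} {zero}  i≢j = refl
  I-offdiag {i = suc i} {suc j} i≢j = I-offdiag (λ i≡j → i≢j (≡.cong suc i≡j))

  I-sym : ∀ n (i j : Fin n) → I n i j ≈ I n j i
  I-sym (suc n) zero    zero    = refl
  I-sym (suc n) zero    (suc j) = refl
  I-sym (suc n) (suc i) zero    = refl
  I-sym (suc n) (suc i) (suc j) = I-sym n i j

  sumF-Iˡ : ∀ n i (f : Vector n) → sumF n (λ j → I n i j * f j) ≈ f i
  sumF-Iˡ (suc n) zero    f = begin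
    1# * f zero + sumF n (λ j → 0# * f (suc j)) ≈⟨ +-cong (*-identityˡ _) (sumF-cong n (λ j → zeroˡ _)) ⟩
    f zero + sumF n (λ _ → 0#)                  ≈⟨ +-congˡ (sumF-0# n) ⟩
    f zero + 0#                                 ≈⟨ +-identityʳ _ ⟩
    f zero                                      ∎
  sumF-Iˡ (suc n) (suc i) f = trans (+-cong (zeroˡ _) (sumF-Iˡ n i (λ j → f (suc j)))) (+-identityˡ _)

  sumF-Iʳ : ∀ n i (f : Vector n) → sumF n (λ j → f j * I n j i) ≈ f i
  sumF-Iʳ n i f = trans (sumF-cong n (λ j → trans (*-comm _ _) (*-congʳ (I-sym n j i)))) (sumF-Iˡ n i f)

  dot : ∀ {n} → Vector n → Vector n → Carrier
  dot {n} u v = sumF n (λ x → u x * v x)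

  dot-comm : ∀ {n} (u v : Vector n) → dot u v ≈ dot v u
  dot-comm {n} u v = sumF-cong n (λ x → *-comm (u x) (v x))

  dot-cong : ∀ {n} {u u' v v' : Vector n} → (∀ x → u x ≈ u' x) → (∀ x → v x ≈ v' x) → dot u v ≈ dot u' v'
  dot-cong {n} u≈u' v≈v' = sumF-cong n (λ x → *-cong (u≈u' x) (v≈v' x))

  dot-linearˡ : ∀ {n} (a w v : Vector n) α → dot (λ x → a x - α * w x) v ≈ dot a v - α * dot w v
  dot-linearˡ {n} a w v α = begin
    sumF n (λ x → (a x - α * w x) * v x)
      ≈⟨ sumF-cong n (λ x → solve 4 (λ a w v α → (a :- α :* w) :* v := a :* v :- α :* (w :* v)) refl (a x) (w x) (v x) α) ⟩
    sumF n (λ x → a x * v x - α * (w x * v x))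
      ≈⟨ sumF-sub n _ _ ⟩
    dot a v - sumF n (λ x → α * (w x * v x))
      ≈⟨ +-congˡ (-‿cong (sumF-*ˡ n α _)) ⟩
    dot a v - α * dot w v ∎

  dot-linearʳ : ∀ {n} (v a w : Vector n) α → dot v (λ x → a x - α * w x) ≈ dot v a - α * dot v w
  dot-linearʳ v a w α = trans (dot-comm v _) (trans (dot-linearˡ a w v α) (+-cong (dot-comm a v) (-‿cong (*-congˡ (dot-comm w v)))))

  Orthonormal : ∀ {n m} → (Fin m → Vector n) → Set ℓ
  Orthonormal {m = m} U = ∀ c d → dot (U c) (U d) ≈ I m c d

  Parseval : ∀ {n m} → (Fin m → Vector n) → Set (c ⊔ ℓ)
  Parseval {m = m} U = ∀ p q → sumF m (λ c → dot (U c) p * dot (U c) q) ≈ dot p q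

  Isometry : ∀ {n} → (Vector n → Vector n) → Set (c ⊔ ℓ)
  Isometry H = ∀ a b → dot (H a) (H b) ≈ dot a b

  module _ {n m} (H : Vector n → Vector n) (isometry : Isometry H) (U : Fin m → Vector n) where

    isometry-orthonormal : Orthonormal U → Orthonormal (λ c → H (U c))
    isometry-orthonormal orthonormal c d = trans (isometry (U c) (U d)) (orthonormal c d)

    isometry-parseval : Parseval (λ c → H (U c)) → Parseval U
    isometry-parseval parseval p q = begin
      sumF m (λ c → dot (U c) p * dot (U c) q)               ≈⟨ sumF-cong m (λ c → sym (*-cong (isometry (U c) p) (isometry (U c) q))) ⟩
      sumF m (λ c → dot (H (U c)) (H p) * dot (H (U c)) (H q)) ≈⟨ parseval (H p) (H q) ⟩
      dot (H p) (H q)                                        ≈⟨ isometry p q ⟩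
      dot p q                                                ∎

  -- For t⟨w,w⟩ = 2 this is the Householder reflection in w⊥.
  reflection : ∀ {n} → Vector n → Carrier → Vector n → Vector n
  reflection w t a x = a x - (t * dot w a) * w x

  reflection-isometry : ∀ {n} (w : Vector n) t → t * dot w w ≈ 1# + 1# → Isometry (reflection w t)
  reflection-isometry w t t*w·w≈2 a b = begin
    dot (reflection w t a) (reflection w t b)
      ≈⟨ dot-linearˡ a w _ (t * A) ⟩
    dot a (reflection w t b) - (t * A) * dot w (reflection w t b)
      ≈⟨ +-cong (dot-linearʳ a b w (t * B)) (-‿cong (*-congˡ (dot-linearʳ w b w (t * B)))) ⟩
    (dot a b - (t * B) * dot a w) - (t * A) * (B - (t * B) * W)
      ≈⟨ +-congʳ (+-congˡ (-‿cong (*-congˡ (dot-comm a w)))) ⟩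
    (dot a b - (t * B) * A) - (t * A) * (B - (t * B) * W)
      ≈⟨ solve 5 (λ D t A B W → (D :- (t :* B) :* A) :- (t :* A) :* (B :- (t :* B) :* W)
                                := D :+ (t :* A :* B) :* (t :* W :- con (+ 2))) refl (dot a b) t A B W ⟩
    dot a b + (t * A * B) * (t * W - (1# + 1#))
      ≈⟨ +-congˡ (trans (*-congˡ (x≈y⇒x-y≈0 t*w·w≈2)) (zeroʳ _)) ⟩
    dot a b + 0#
      ≈⟨ +-identityʳ _ ⟩
    dot a b ∎
    where
    A = dot w a
    B = dot w b
    W = dot w w

  opposite-sign : ∀ x → ∃[ s ] (s * s ≈ 1#) × (0# ≤ (- (s * x)))
  opposite-sign x with ≤.total 0# x
  ... | inj₁ 0≤x = - 1# , solve 0 (:- con (+ 1) :* :- con (+ 1) := con (+ 1)) refl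
                        , ≤-resp-≈ refl (solve 1 (λ x → x := :- (:- con (+ 1) :* x)) refl x) 0≤x
  ... | inj₂ x≤0 = 1# , *-identityˡ 1# , ≤-resp-≈ refl (-‿cong (sym (*-identityˡ x))) (x≤0⇒0≤-x x≤0)

  -- w = u − s e₀ with the sign s chosen so that ⟨w,u⟩ = 1 − s u₀ is invertible.
  reflection-to-axis : ∀ {m} (u : Vector (suc m)) → dot u u ≈ 1# →
    ∃₂ λ w t → (t * dot w w ≈ 1# + 1#) × ∃[ s ] (s * s ≈ 1#) × (∀ x → reflection w t u x ≈ s * I (suc m) zero x)
  reflection-to-axis {m} u u·u≈1 = w , t , t*w·w≈2 , s , s*s≈1 , reflect-u
    where
    s = proj₁ (opposite-sign (u zero))
    s*s≈1 = proj₁ (proj₂ (opposite-sign (u zero)))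
    g = 1# - s * u zero
    g≉0 : ¬ (g ≈ 0#)
    g≉0 = 1+x≉0 (proj₂ (proj₂ (opposite-sign (u zero))))
    t = proj₁ (inverse g g≉0)
    t*g≈1 : t * g ≈ 1#
    t*g≈1 = trans (*-comm t g) (proj₂ (inverse g g≉0))
    e₀ = I (suc m) zero
    w : Vector (suc m)
    w x = u x - s * e₀ x
    w·a : ∀ a → dot w a ≈ dot u a - s * a zero
    w·a a = trans (dot-linearˡ u e₀ a s) (+-congˡ (-‿cong (*-congˡ (sumF-Iˡ (suc m) zero a))))
    w·u≈g : dot w u ≈ g
    w·u≈g = trans (w·a u) (+-congʳ u·u≈1)
    t*w·w≈2 : t * dot w w ≈ 1# + 1#
    t*w·w≈2 = begin
      t * dot w w
        ≈⟨ *-congˡ (w·a w) ⟩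
      t * (dot u w - s * (u zero - s * 1#))
        ≈⟨ *-congˡ (+-congʳ (trans (dot-comm u w) w·u≈g)) ⟩
      t * (g - s * (u zero - s * 1#))
        ≈⟨ solve 3 (λ t s u → t :* ((con (+ 1) :- s :* u) :- s :* (u :- s :* con (+ 1)))
                            := t :* (con (+ 1) :- s :* u) :+ t :* ((con (+ 1) :- s :* u) :+ s :* s :- con (+ 1)))
                   refl t s (u zero) ⟩
      t * g + t * (g + s * s - 1#)
        ≈⟨ +-congˡ (*-congˡ (+-congʳ (+-congˡ s*s≈1))) ⟩
      t * g + t * (g + 1# - 1#)
        ≈⟨ +-congˡ (*-congˡ (solve 1 (λ g → g :+ con (+ 1) :- con (+ 1) := g) refl g)) ⟩
      t * g + t * g
        ≈⟨ +-cong t*g≈1 t*g≈1 ⟩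
      1# + 1# ∎
    reflect-u : ∀ x → reflection w t u x ≈ s * e₀ x
    reflect-u x = begin
      u x - (t * dot w u) * w x    ≈⟨ +-congˡ (-‿cong (*-congʳ (trans (*-congˡ w·u≈g) t*g≈1))) ⟩
      u x - 1# * (u x - s * e₀ x)  ≈⟨ solve 3 (λ u s e → u :- con (+ 1) :* (u :- s :* e) := s :* e) refl (u x) s (e₀ x) ⟩
      s * e₀ x                     ∎

  tailV : ∀ {m} → (Fin (suc m) → Vector (suc m)) → Fin m → Vector m
  tailV V d x = V (suc d) (suc x)

  module _ {m} {s} (V : Fin (suc m) → Vector (suc m)) (s*s≈1 : s * s ≈ 1#)
           (V₀≈s*e₀ : ∀ x → V zero x ≈ s * I (suc m) zero x) (orthonormal : Orthonormal V) where

    private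
      e₀ = I (suc m) zero

      V₀·p : ∀ p → dot (V zero) p ≈ s * p zero
      V₀·p p = begin
        dot (V zero) p                         ≈⟨ dot-cong {v = p} V₀≈s*e₀ (λ x → refl) ⟩
        sumF (suc m) (λ x → (s * e₀ x) * p x)  ≈⟨ sumF-cong (suc m) (λ x → *-assoc s (e₀ x) (p x)) ⟩
        sumF (suc m) (λ x → s * (e₀ x * p x))  ≈⟨ sumF-*ˡ (suc m) s (λ x → e₀ x * p x) ⟩
        s * sumF (suc m) (λ x → e₀ x * p x)    ≈⟨ *-congˡ (sumF-Iˡ (suc m) zero p) ⟩
        s * p zero                             ∎

      s≉0 : ¬ (s ≈ 0#)
      s≉0 s≈0 = 0≉1 (trans (sym (zeroˡ s)) (trans (*-congʳ (sym s≈0)) s*s≈1))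

      Vsuc₀≈0 : ∀ d → V (suc d) zero ≈ 0#
      Vsuc₀≈0 d = x*y≈0⇒y≈0 s≉0 (trans (sym (V₀·p (V (suc d)))) (orthonormal zero (suc d)))

      Vsuc·p : ∀ d p → dot (V (suc d)) p ≈ dot (tailV V d) (λ x → p (suc x))
      Vsuc·p d p = trans (+-congʳ (trans (*-congʳ (Vsuc₀≈0 d)) (zeroˡ _))) (+-identityˡ _)

    tailV-orthonormal : Orthonormal (tailV V)
    tailV-orthonormal c d = trans (sym (Vsuc·p c (V (suc d)))) (orthonormal (suc c) (suc d))

    tailV-parseval⇒parseval : Parseval (tailV V) → Parseval V
    tailV-parseval⇒parseval parseval p q = +-cong head (trans tail (parseval _ _))
      where
      head : dot (V zero) p * dot (V zero) q ≈ p zero * q zero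
      head = begin
        dot (V zero) p * dot (V zero) q ≈⟨ *-cong (V₀·p p) (V₀·p q) ⟩
        (s * p zero) * (s * q zero)     ≈⟨ interchange* s (p zero) s (q zero) ⟩
        (s * s) * (p zero * q zero)     ≈⟨ trans (*-congʳ s*s≈1) (*-identityˡ _) ⟩
        p zero * q zero                 ∎
      tail : sumF m (λ d → dot (V (suc d)) p * dot (V (suc d)) q)
           ≈ sumF m (λ d → dot (tailV V d) (λ x → p (suc x)) * dot (tailV V d) (λ x → q (suc x)))
      tail = sumF-cong m (λ d → *-cong (Vsuc·p d p) (Vsuc·p d q))

  -- UᵀU = I implies UUᵀ = I for square U: a reflection moves U₀ to ±e₀ and hence the other
  -- vectors into e₀⊥, where induction applies.
  orthonormal⇒parseval : ∀ n (U : Fin n → Vector n) → Orthonormal U → Parseval U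
  orthonormal⇒parseval zero    U orthonormal p q = refl
  orthonormal⇒parseval (suc m) U orthonormal =
    let w , t , t*w·w≈2 , s , s*s≈1 , reflect-U₀ = reflection-to-axis (U zero) (orthonormal zero zero)
        H = reflection w t
        H-isometry : Isometry H
        H-isometry = reflection-isometry w t t*w·w≈2
        V : Fin (suc m) → Vector (suc m)
        V c = H (U c)
        V-orthonormal : Orthonormal V
        V-orthonormal = isometry-orthonormal H H-isometry U orthonormal
    in isometry-parseval H H-isometry U
         (tailV-parseval⇒parseval V s*s≈1 reflect-U₀ V-orthonormal
           (orthonormal⇒parseval m (tailV V) (tailV-orthonormal V s*s≈1 reflect-U₀ V-orthonormal)))

  column : ∀ {n m} → Mat n m → Fin m → Vector n
  column Q c x = Q x c

  module _ {m} (Q : Mat (suc m) m) (restrictor : IsRestrictor Q) where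

    restrictor-columnSum : ∀ c → sumF (suc m) (column Q c) ≈ 0#
    restrictor-columnSum c = trans (sumF-cong (suc m) (λ x → sym (*-identityʳ (Q x c)))) (proj₂ restrictor c zero)

    -- Q together with the unit vector e/√(m+1) is an orthonormal basis.
    restrictor-parseval : ∀ p q →
      sumF m (λ c → dot (column Q c) p * dot (column Q c) q) ≈ dot p q - 1/suc m * (sumF (suc m) p * sumF (suc m) q)
    restrictor-parseval p q = begin
      sumF m (λ c → dot (column Q c) p * dot (column Q c) q)
        ≈⟨ solve 2 (λ x y → x := (y :+ x) :- y) refl _ (dot (U zero) p * dot (U zero) q) ⟩
      parsevalSum - dot (U zero) p * dot (U zero) q
        ≈⟨ +-cong (orthonormal⇒parseval (suc m) U U-orthonormal p q) (-‿cong e-part) ⟩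
      dot p q - 1/suc m * (sumF (suc m) p * sumF (suc m) q) ∎
      where
      r = proj₁ (inverseSqrt m)
      r*r≈1/suc : r * r ≈ 1/suc m
      r*r≈1/suc = inverse-unique (proj₂ (inverseSqrt m)) (*-1/suc m)
      U : Fin (suc m) → Vector (suc m)
      U zero    x = r
      U (suc c) x = Q x c
      parsevalSum = sumF (suc m) (λ c → dot (U c) p * dot (U c) q)
      r·Qc≈0 : ∀ c → sumF (suc m) (λ x → r * Q x c) ≈ 0#
      r·Qc≈0 c = trans (sumF-*ˡ (suc m) r (column Q c)) (trans (*-congˡ (restrictor-columnSum c)) (zeroʳ r))
      U-orthonormal : Orthonormal U
      U-orthonormal zero    zero    = trans (sumF-const (suc m) (r * r)) (proj₂ (inverseSqrt m))
      U-orthonormal zero    (suc d) = r·Qc≈0 d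
      U-orthonormal (suc c) zero    = trans (sumF-cong (suc m) (λ x → *-comm (Q x c) r)) (r·Qc≈0 c)
      U-orthonormal (suc c) (suc d) = proj₁ restrictor c d
      e-part : dot (U zero) p * dot (U zero) q ≈ 1/suc m * (sumF (suc m) p * sumF (suc m) q)
      e-part = begin
        dot (U zero) p * dot (U zero) q                    ≈⟨ *-cong (sumF-*ˡ (suc m) r p) (sumF-*ˡ (suc m) r q) ⟩
        (r * sumF (suc m) p) * (r * sumF (suc m) q)        ≈⟨ interchange* r _ r _ ⟩
        (r * r) * (sumF (suc m) p * sumF (suc m) q)        ≈⟨ *-congʳ r*r≈1/suc ⟩
        1/suc m * (sumF (suc m) p * sumF (suc m) q)        ∎

    orthogonal-to-columns⇒orthogonal-to-sumZero : ∀ z → (∀ c → dot (column Q c) z ≈ 0#) →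
      ∀ u → sumF (suc m) u ≈ 0# → dot u z ≈ 0#
    orthogonal-to-columns⇒orthogonal-to-sumZero z Q⊥z u Σu≈0 = begin
      dot u z
        ≈⟨ solve 3 (λ d w Σz → d := d :- w :* (con (+ 0) :* Σz)) refl (dot u z) (1/suc m) (sumF (suc m) z) ⟩
      dot u z - 1/suc m * (0# * sumF (suc m) z)
        ≈⟨ +-congˡ (-‿cong (*-congˡ (*-congʳ (sym Σu≈0)))) ⟩
      dot u z - 1/suc m * (sumF (suc m) u * sumF (suc m) z)
        ≈⟨ sym (restrictor-parseval u z) ⟩
      sumF m (λ c → dot (column Q c) u * dot (column Q c) z)
        ≈⟨ sumF-cong m (λ c → trans (*-congˡ (Q⊥z c)) (zeroʳ _)) ⟩
      sumF m (λ _ → 0#)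
        ≈⟨ sumF-0# m ⟩
      0# ∎

  -- Helmert's construction: Q' is Q with a zero row on top and the unit column (-(m+1)a, a, …, a)
  -- in front, where (m+1)(m+2)a² = 1.
  helmert : ∀ m → Σ (Mat (suc m) m) IsRestrictor
  helmert zero    = (λ x ()) , (λ ()) , (λ ())
  helmert (suc m) = Q' , Q'-orthonormal , Q'⊥e
    where
    Q = proj₁ (helmert m)
    restrictor = proj₂ (helmert m)
    n = fromℕ (suc m)
    a₁ = proj₁ (inverseSqrt m)
    a₂ = proj₁ (inverseSqrt (suc m))
    a = a₁ * a₂
    n[1+n]a²≈1 : (n * (1# + n)) * (a * a) ≈ 1#
    n[1+n]a²≈1 = begin
      (n * (1# + n)) * (a * a)                  ≈⟨ solve 4 (λ n n' a₁ a₂ → (n :* n') :* ((a₁ :* a₂) :* (a₁ :* a₂))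
                                                                    := (n :* (a₁ :* a₁)) :* (n' :* (a₂ :* a₂))) refl n (1# + n) a₁ a₂ ⟩
      (n * (a₁ * a₁)) * ((1# + n) * (a₂ * a₂))
        ≈⟨ *-cong (proj₂ (inverseSqrt m)) (trans (*-congʳ (sym (fromℕ-suc (suc m)))) (proj₂ (inverseSqrt (suc m)))) ⟩
      1# * 1#
        ≈⟨ *-identityˡ 1# ⟩
      1# ∎
    Q' : Mat (suc (suc m)) (suc m)
    Q' zero    zero    = - (n * a)
    Q' zero    (suc j) = 0#
    Q' (suc x) zero    = a
    Q' (suc x) (suc j) = Q x j
    a·Qc≈0 : ∀ c → sumF (suc m) (λ x → a * Q x c) ≈ 0#
    a·Qc≈0 c = trans (sumF-*ˡ (suc m) a (column Q c)) (trans (*-congˡ (restrictor-columnSum Q restrictor c)) (zeroʳ a))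
    Q'-orthonormal : ((Q' ᵀ) ⊠ Q') ≋ I (suc m)
    Q'-orthonormal zero zero = begin
      - (n * a) * - (n * a) + sumF (suc m) (λ _ → a * a)
        ≈⟨ +-congˡ (sumF-const (suc m) (a * a)) ⟩
      - (n * a) * - (n * a) + n * (a * a)
        ≈⟨ solve 2 (λ n a → :- (n :* a) :* :- (n :* a) :+ n :* (a :* a) := (n :* (con (+ 1) :+ n)) :* (a :* a)) refl n a ⟩
      (n * (1# + n)) * (a * a)
        ≈⟨ n[1+n]a²≈1 ⟩
      1# ∎
    Q'-orthonormal zero    (suc d) = trans (+-cong (zeroʳ _) (a·Qc≈0 d)) (+-identityˡ 0#)
    Q'-orthonormal (suc c) zero    = trans (+-cong (zeroˡ _) (trans (sumF-cong (suc m) (λ x → *-comm (Q x c) a)) (a·Qc≈0 c))) (+-identityˡ 0#)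
    Q'-orthonormal (suc c) (suc d) = trans (+-cong (zeroˡ 0#) (proj₁ restrictor c d)) (+-identityˡ _)
    Q'⊥e : ((Q' ᵀ) ⊠ 𝐞 (suc (suc m))) ≋ 𝟎 (suc m) 1
    Q'⊥e zero _ = begin
      - (n * a) * 1# + sumF (suc m) (λ _ → a * 1#) ≈⟨ +-congˡ (sumF-const (suc m) (a * 1#)) ⟩
      - (n * a) * 1# + n * (a * 1#)                ≈⟨ solve 2 (λ n a → :- (n :* a) :* con (+ 1) :+ n :* (a :* con (+ 1)) := con (+ 0)) refl n a ⟩
      0#                                           ∎
    Q'⊥e (suc d) z = trans (+-cong (zeroˡ 1#) (proj₂ restrictor d z)) (+-identityˡ 0#)

  infixr 7 _▷_
  infixl 7 _◁_

  _▷_ : ∀ {m n} → Mat m n → Vector n → Vector m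
  _▷_ {n = n} L u x = sumF n (λ y → L x y * u y)

  _◁_ : ∀ {m n} → Vector m → Mat m n → Vector n
  _◁_ {m = m} u L y = sumF m (λ x → u x * L x y)

  ▷-congʳ : ∀ {m n} (L : Mat m n) {u v : Vector n} → (∀ y → u y ≈ v y) → ∀ x → (L ▷ u) x ≈ (L ▷ v) x
  ▷-congʳ {n = n} L u≈v x = sumF-cong n (λ y → *-congˡ (u≈v y))

  ◁-congˡ : ∀ {m n} (L : Mat m n) {u v : Vector m} → (∀ x → u x ≈ v x) → ∀ y → (u ◁ L) y ≈ (v ◁ L) y
  ◁-congˡ {m = m} L u≈v y = sumF-cong m (λ x → *-congʳ (u≈v x))

  ◁-adjoint : ∀ {m n} (u : Vector m) (L : Mat m n) (v : Vector n) → dot (u ◁ L) v ≈ dot u (L ▷ v)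
  ◁-adjoint {m} {n} u L v = begin
    sumF n (λ y → sumF m (λ x → u x * L x y) * v y)   ≈⟨ sumF-cong n (λ y → sym (sumF-*ʳ m _ (v y))) ⟩
    sumF n (λ y → sumF m (λ x → u x * L x y * v y))   ≈⟨ sumF-swap n m _ ⟩
    sumF m (λ x → sumF n (λ y → u x * L x y * v y))   ≈⟨ sumF-cong m (λ x → trans (sumF-cong n (λ y → *-assoc (u x) _ _)) (sumF-*ˡ n (u x) _)) ⟩
    sumF m (λ x → u x * sumF n (λ y → L x y * v y))   ∎

  commutatorForm : ∀ {n} → Mat n n → Vector n → Vector n → Carrier
  commutatorForm L u v = dot (u ◁ L) (v ◁ L) - dot (L ▷ u) (L ▷ v)

  commutatorForm-cong : ∀ {n} (L : Mat n n) {u u' v v' : Vector n} → (∀ x → u x ≈ u' x) → (∀ x → v x ≈ v' x) →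
    commutatorForm L u v ≈ commutatorForm L u' v'
  commutatorForm-cong L u≈u' v≈v' =
    +-cong (dot-cong (◁-congˡ L u≈u') (◁-congˡ L v≈v')) (-‿cong (dot-cong (▷-congʳ L u≈u') (▷-congʳ L v≈v')))

  commutatorForm-I : ∀ {n} (L : Mat n n) i j → commutatorForm L (I n i) (I n j) ≈ (L ⊠ (L ᵀ)) i j - ((L ᵀ) ⊠ L) i j
  commutatorForm-I {n} L i j =
    +-cong (dot-cong (I◁L i) (I◁L j)) (-‿cong (dot-cong (L▷I i) (L▷I j)))
    where
    I◁L : ∀ i y → (I n i ◁ L) y ≈ L i y
    I◁L i y = sumF-Iˡ n i (λ x → L x y)
    L▷I : ∀ i x → (L ▷ I n i) x ≈ L x i
    L▷I i x = trans (sumF-cong n (λ y → *-congˡ (I-sym n i y))) (sumF-Iʳ n i (L x))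

  -- The bilinear form of LLᵀ − LᵀPL with P = I − J/(m+1). For a restrictor Q we have QQᵀ = P, so
  -- when Le = 0 the entries of YYᵀ − YᵀY, Y = QᵀLQ, are its values on columns of Q.
  defectForm : ∀ {m} → Mat (suc m) (suc m) → Vector (suc m) → Vector (suc m) → Carrier
  defectForm {m} L u v = commutatorForm L u v + 1/suc m * (sumF (suc m) (L ▷ u) * sumF (suc m) (L ▷ v))

  defectForm-sym : ∀ {m} (L : Mat (suc m) (suc m)) u v → defectForm L u v ≈ defectForm L v u
  defectForm-sym L u v = +-cong (+-cong (dot-comm (u ◁ L) (v ◁ L)) (-‿cong (dot-comm (L ▷ u) (L ▷ v)))) (*-congˡ (*-comm _ _))

  module _ {m} (L : Mat (suc m) (suc m)) where
    private
      N = suc m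
      ones : Vector N
      ones _ = 1#

    defectVector : Vector N → Vector N
    defectVector v x = (L ▷ (v ◁ L)) x - ((L ▷ v) ◁ L) x + (1/suc m * sumF N (L ▷ v)) * (ones ◁ L) x

    defectForm-dot : ∀ u v → defectForm L u v ≈ dot u (defectVector v)
    defectForm-dot u v = sym (begin
      dot u (defectVector v)
        ≈⟨ expand ⟩
      dot u a - dot u b + k * dot u (ones ◁ L)
        ≈⟨ +-cong (+-cong a-part (-‿cong b-part)) (*-congˡ ones-part) ⟩
      commutatorForm L u v + k * sumF N (L ▷ u)
        ≈⟨ +-congˡ (solve 3 (λ w x y → (w :* y) :* x := w :* (x :* y)) refl (1/suc m) (sumF N (L ▷ u)) (sumF N (L ▷ v))) ⟩
      defectForm L u v                              ∎)
      where
      a = L ▷ (v ◁ L)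
      b = (L ▷ v) ◁ L
      k = 1/suc m * sumF N (L ▷ v)
      expand : dot u (defectVector v) ≈ dot u a - dot u b + k * dot u (ones ◁ L)
      expand = begin
        sumF N (λ x → u x * (a x - b x + k * (ones ◁ L) x))
          ≈⟨ sumF-cong N (λ x → solve 5 (λ u a b k c → u :* (a :- b :+ k :* c) := (u :* a :- u :* b) :+ k :* (u :* c))
                                        refl (u x) (a x) (b x) k ((ones ◁ L) x)) ⟩
        sumF N (λ x → (u x * a x - u x * b x) + k * (u x * (ones ◁ L) x))
          ≈⟨ trans (sumF-+ N (λ x → u x * a x - u x * b x) (λ x → k * (u x * (ones ◁ L) x)))
                   (+-cong (sumF-sub N (λ x → u x * a x) (λ x → u x * b x)) (sumF-*ˡ N k (λ x → u x * (ones ◁ L) x))) ⟩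
        dot u a - dot u b + k * dot u (ones ◁ L) ∎
      a-part : dot u a ≈ dot (u ◁ L) (v ◁ L)
      a-part = sym (◁-adjoint u L (v ◁ L))
      b-part : dot u b ≈ dot (L ▷ u) (L ▷ v)
      b-part = trans (dot-comm u b) (trans (◁-adjoint (L ▷ v) L u) (dot-comm (L ▷ v) (L ▷ u)))
      ones-part : dot u (ones ◁ L) ≈ sumF N (L ▷ u)
      ones-part = trans (dot-comm u (ones ◁ L)) (trans (◁-adjoint ones L u) (sumF-cong N (λ x → *-identityˡ ((L ▷ u) x))))

    module _ (Q : Mat N m) (restrictor : IsRestrictor Q) where

      defectForm-columns⇒sumZero : (∀ c d → defectForm L (column Q c) (column Q d) ≈ 0#) →
        ∀ u v → sumF N u ≈ 0# → sumF N v ≈ 0# → defectForm L u v ≈ 0#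
      defectForm-columns⇒sumZero defect≈0 u v Σu≈0 Σv≈0 =
        trans (defectForm-dot u v) (orthogonal-to-columns⇒orthogonal-to-sumZero Q restrictor (defectVector v) Q⊥Rv u Σu≈0)
        where
        Q⊥Rq : ∀ c d → dot (column Q d) (defectVector (column Q c)) ≈ 0#
        Q⊥Rq c d = trans (sym (defectForm-dot (column Q d) (column Q c))) (defect≈0 d c)
        Q⊥Rv : ∀ c → dot (column Q c) (defectVector v) ≈ 0#
        Q⊥Rv c = begin
          dot (column Q c) (defectVector v)
            ≈⟨ sym (defectForm-dot (column Q c) v) ⟩
          defectForm L (column Q c) v
            ≈⟨ defectForm-sym L (column Q c) v ⟩
          defectForm L v (column Q c)
            ≈⟨ defectForm-dot v (column Q c) ⟩
          dot v (defectVector (column Q c))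
            ≈⟨ orthogonal-to-columns⇒orthogonal-to-sumZero Q restrictor (defectVector (column Q c)) (Q⊥Rq c) v Σv≈0 ⟩
          0# ∎

    module _ (rowSum≈0 : ∀ x → sumF N (L x) ≈ 0#) (Q : Mat N m) (restrictor : IsRestrictor Q) where
      private
        Y = ((Q ᵀ) ⊠ L) ⊠ Q
        q = column Q

        Σ[q◁L]≈0 : ∀ c → sumF N (q c ◁ L) ≈ 0#
        Σ[q◁L]≈0 c = begin
          sumF N (q c ◁ L)                 ≈⟨ sumF-cong N (λ y → sym (*-identityʳ ((q c ◁ L) y))) ⟩
          dot (q c ◁ L) ones               ≈⟨ ◁-adjoint (q c) L ones ⟩
          dot (q c) (L ▷ ones)             ≈⟨ sumF-cong N (λ x → *-congˡ {q c x} (trans (sumF-cong N (λ y → *-identityʳ (L x y))) (rowSum≈0 x))) ⟩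
          sumF N (λ x → q c x * 0#)        ≈⟨ trans (sumF-cong N (λ x → zeroʳ (q c x))) (sumF-0# N) ⟩
          0#                               ∎

        YYᵀ : ∀ c d → (Y ⊠ (Y ᵀ)) c d ≈ dot (q c ◁ L) (q d ◁ L)
        YYᵀ c d = begin
          sumF m (λ e → dot (q c ◁ L) (q e) * dot (q d ◁ L) (q e))
            ≈⟨ sumF-cong m (λ e → *-cong (dot-comm (q c ◁ L) (q e)) (dot-comm (q d ◁ L) (q e))) ⟩
          sumF m (λ e → dot (q e) (q c ◁ L) * dot (q e) (q d ◁ L))
            ≈⟨ restrictor-parseval Q restrictor (q c ◁ L) (q d ◁ L) ⟩
          dot (q c ◁ L) (q d ◁ L) - 1/suc m * (sumF N (q c ◁ L) * sumF N (q d ◁ L))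
            ≈⟨ +-congˡ (-‿cong (*-congˡ (trans (*-congʳ (Σ[q◁L]≈0 c)) (zeroˡ (sumF N (q d ◁ L)))))) ⟩
          dot (q c ◁ L) (q d ◁ L) - 1/suc m * 0#
            ≈⟨ solve 2 (λ x w → x :- w :* con (+ 0) := x) refl (dot (q c ◁ L) (q d ◁ L)) (1/suc m) ⟩
          dot (q c ◁ L) (q d ◁ L) ∎

        YᵀY : ∀ c d → ((Y ᵀ) ⊠ Y) c d ≈ dot (L ▷ q c) (L ▷ q d) - 1/suc m * (sumF N (L ▷ q c) * sumF N (L ▷ q d))
        YᵀY c d = trans (sumF-cong m (λ e → *-cong (◁-adjoint (q e) L (q c)) (◁-adjoint (q e) L (q d))))
                        (restrictor-parseval Q restrictor (L ▷ q c) (L ▷ q d))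

      normality-defect : ∀ c d → (Y ⊠ (Y ᵀ)) c d - ((Y ᵀ) ⊠ Y) c d ≈ defectForm L (q c) (q d)
      normality-defect c d = trans (+-cong (YYᵀ c d) (-‿cong (YᵀY c d)))
        (solve 3 (λ x y z → x :- (y :- z) := (x :- y) :+ z) refl (dot (q c ◁ L) (q d ◁ L)) (dot (L ▷ q c) (L ▷ q d))
                (1/suc m * (sumF N (L ▷ q c) * sumF N (L ▷ q d))))

      normal⇒defectForm-columns : Normal Y → ∀ c d → defectForm L (q c) (q d) ≈ 0#
      normal⇒defectForm-columns normal c d = trans (sym (normality-defect c d)) (x≈y⇒x-y≈0 (normal c d))

      defectForm-columns⇒normal : (∀ c d → defectForm L (q c) (q d) ≈ 0#) → Normal Y
      defectForm-columns⇒normal defect≈0 c d = x-y≈0⇒x≈y (trans (normality-defect c d) (defect≈0 c d))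

  module _ {n} (Γ : Digraph n) where
    private
      L = laplacian Γ
      A = adjacency Γ
      d = outdeg Γ

    laplacian-entry : ∀ x y → L x y ≈ d x * I n x y - A x y
    laplacian-entry x y = +-congʳ (if-I (does (x Fin.≟ y)))
      where
      if-I : ∀ b → (if b then d x else 0#) ≈ d x * (if b then 1# else 0#)
      if-I true  = sym (*-identityʳ (d x))
      if-I false = sym (zeroʳ (d x))

    laplacian-rowSum : ∀ x → sumF n (L x) ≈ 0#
    laplacian-rowSum x = begin
      sumF n (L x)                                ≈⟨ sumF-cong n (laplacian-entry x) ⟩
      sumF n (λ y → d x * I n x y - A x y)        ≈⟨ sumF-sub n _ (A x) ⟩
      sumF n (λ y → d x * I n x y) - d x          ≈⟨ +-congʳ (trans (sumF-*ˡ n (d x) (I n x)) (*-congˡ (I-rowSum x))) ⟩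
      d x * 1# - d x                              ≈⟨ trans (+-congʳ (*-identityʳ (d x))) (-‿inverseʳ (d x)) ⟩
      0#                                          ∎
      where
      I-rowSum : ∀ x → sumF n (I n x) ≈ 1#
      I-rowSum x = trans (sumF-cong n (λ y → sym (*-identityʳ (I n x y)))) (sumF-Iˡ n x (λ _ → 1#))

    laplacian-▷ : ∀ u x → (L ▷ u) x ≈ u x * d x - (A ▷ u) x
    laplacian-▷ u x = begin
      sumF n (λ y → L x y * u y)
        ≈⟨ sumF-cong n (λ y → trans (*-congʳ (laplacian-entry x y))
             (solve 4 (λ d i a u → (d :* i :- a) :* u := d :* (i :* u) :- a :* u) refl (d x) (I n x y) (A x y) (u y))) ⟩
      sumF n (λ y → d x * (I n x y * u y) - A x y * u y)
        ≈⟨ sumF-sub n _ _ ⟩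
      sumF n (λ y → d x * (I n x y * u y)) - (A ▷ u) x
        ≈⟨ +-congʳ (trans (sumF-*ˡ n (d x) _) (trans (*-congˡ (sumF-Iˡ n x u)) (*-comm _ _))) ⟩
      u x * d x - (A ▷ u) x ∎

    laplacian-◁ : ∀ u y → (u ◁ L) y ≈ u y * d y - (u ◁ A) y
    laplacian-◁ u y = begin
      sumF n (λ x → u x * L x y)
        ≈⟨ sumF-cong n (λ x → trans (*-congˡ (laplacian-entry x y))
             (solve 4 (λ d i a u → u :* (d :* i :- a) := (d :* u) :* i :- u :* a) refl (d x) (I n x y) (A x y) (u x))) ⟩
      sumF n (λ x → (d x * u x) * I n x y - u x * A x y)
        ≈⟨ sumF-sub n _ _ ⟩
      sumF n (λ x → (d x * u x) * I n x y) - (u ◁ A) y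
        ≈⟨ +-congʳ (trans (sumF-Iʳ n y (λ x → d x * u x)) (*-comm _ _)) ⟩
      u y * d y - (u ◁ A) y ∎

  sumF-++ : ∀ k m (f : Vector (k ℕ.+ m)) → sumF (k ℕ.+ m) f ≈ sumF k (λ a → f (a ↑ˡ m)) + sumF m (λ b → f (k ↑ʳ b))
  sumF-++ zero    m f = sym (+-identityˡ _)
  sumF-++ (suc k) m f = trans (+-congˡ (sumF-++ k m (λ z → f (suc z)))) (sym (+-assoc _ _ _))

  sumF-combine : ∀ n k (f : Vector (n ℕ.* k)) → sumF (n ℕ.* k) f ≈ sumF n (λ i → sumF k (λ a → f (combine i a)))
  sumF-combine zero    k f = refl
  sumF-combine (suc n) k f = trans (sumF-++ k (n ℕ.* k) f) (+-congˡ (sumF-combine n k (λ z → f (k ↑ʳ z))))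

  sumF-affine-product : ∀ k (X Y : Vector k) p α β →
    sumF k (λ b → (X b * p - α) * (Y b * p - β)) ≈
    (((p * p) * sumF k (λ b → X b * Y b) - (p * α) * sumF k Y) - (p * β) * sumF k X) + fromℕ k * (α * β)
  sumF-affine-product k X Y p α β = begin
    sumF k (λ b → (X b * p - α) * (Y b * p - β))
      ≈⟨ sumF-cong k (λ b → solve 5 (λ X Y p α β → (X :* p :- α) :* (Y :* p :- β) :=
           (((p :* p) :* (X :* Y) :- (p :* α) :* Y) :- (p :* β) :* X) :+ α :* β) refl (X b) (Y b) p α β) ⟩
    sumF k (λ b → (((p * p) * (X b * Y b) - (p * α) * Y b) - (p * β) * X b) + α * β)
      ≈⟨ sumF-+ k _ _ ⟩
    sumF k (λ b → ((p * p) * (X b * Y b) - (p * α) * Y b) - (p * β) * X b) + sumF k (λ _ → α * β)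
      ≈⟨ +-cong (trans (sumF-sub k _ _) (+-cong (sumF-sub k _ _) (-‿cong (sumF-*ˡ k _ X)))) (sumF-const k (α * β)) ⟩
    (sumF k (λ b → (p * p) * (X b * Y b)) - sumF k (λ b → (p * α) * Y b) - (p * β) * sumF k X) + fromℕ k * (α * β)
      ≈⟨ +-congʳ (+-congʳ (+-cong (sumF-*ˡ k _ _) (-‿cong (sumF-*ˡ k _ Y)))) ⟩
    (((p * p) * sumF k (λ b → X b * Y b) - (p * α) * sumF k Y) - (p * β) * sumF k X) + fromℕ k * (α * β) ∎

  blockSum : ∀ {n} k → Vector (n ℕ.* k) → Vector n
  blockSum k x i = sumF k (λ a → x (combine i a))

  blockSum-sumF : ∀ {n} k (x : Vector (n ℕ.* k)) → sumF n (blockSum k x) ≈ sumF (n ℕ.* k) x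
  blockSum-sumF {n} k x = sym (sumF-combine n k x)

  blockSum-I : ∀ {n k} (i j : Fin n) → blockSum (suc k) (I (n ℕ.* suc k) (combine i zero)) j ≈ I n i j
  blockSum-I {n} {k} i j with i Fin.≟ j
  ... | yes ≡.refl = begin
    I N (combine i zero) (combine i zero) + sumF k (λ b → I N (combine i zero) (combine i (suc b)))
      ≈⟨ +-cong (I-diag (combine i zero))
                (trans (sumF-cong k (λ b → I-offdiag (zero≢suc ∘ combine-injectiveʳ i zero i (suc b)))) (sumF-0# k)) ⟩
    1# + 0#
      ≈⟨ +-identityʳ 1# ⟩
    1# ∎
    where
    N = n ℕ.* suc k
    zero≢suc : ∀ {b : Fin k} → zero ≢ suc b
    zero≢suc ()
  ... | no i≢j = trans (sumF-cong (suc k) (λ b → I-offdiag (i≢j ∘ combine-injectiveˡ i zero j b)))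
                       (sumF-0# (suc k))

  module _ {n} (Γ : Digraph n) (k : ℕ) where
    private
      N = n ℕ.* k
      Γ̂ = blowup Γ k
      A = adjacency Γ
      Â = adjacency Γ̂
      d = outdeg Γ
      L = laplacian Γ
      L̂ = laplacian Γ̂
      p : Vector n
      p i = fromℕ k * d i

      Â-combine : ∀ i a j b → Â (combine i a) (combine j b) ≈ A i j
      Â-combine i a j b = reflexive (≡.cong fromBool (blowup-adj-combine Γ k i a j b))

    blowup-outdeg : ∀ i a → outdeg Γ̂ (combine i a) ≈ p i
    blowup-outdeg i a = begin
      sumF N (Â (combine i a))
        ≈⟨ sumF-combine n k _ ⟩
      sumF n (λ j → sumF k (λ b → Â (combine i a) (combine j b)))
        ≈⟨ sumF-cong n (λ j → trans (sumF-cong k (Â-combine i a j)) (sumF-const k (A i j))) ⟩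
      sumF n (λ j → fromℕ k * A i j)
        ≈⟨ sumF-*ˡ n (fromℕ k) (A i) ⟩
      p i ∎

    blowup-adjacency-▷ : ∀ x i a → (Â ▷ x) (combine i a) ≈ (A ▷ blockSum k x) i
    blowup-adjacency-▷ x i a = trans (sumF-combine n k _) (sumF-cong n (λ j →
      trans (sumF-cong k (λ b → *-congʳ (Â-combine i a j b))) (sumF-*ˡ k (A i j) _)))

    blowup-adjacency-◁ : ∀ x j b → (x ◁ Â) (combine j b) ≈ (blockSum k x ◁ A) j
    blowup-adjacency-◁ x j b = trans (sumF-combine n k _) (sumF-cong n (λ i →
      trans (sumF-cong k (λ a → *-congˡ (Â-combine i a j b))) (sumF-*ʳ k _ (A i j))))

    blowup-laplacian-▷ : ∀ x i a → (L̂ ▷ x) (combine i a) ≈ x (combine i a) * p i - (A ▷ blockSum k x) i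
    blowup-laplacian-▷ x i a =
      trans (laplacian-▷ Γ̂ x (combine i a)) (+-cong (*-congˡ (blowup-outdeg i a)) (-‿cong (blowup-adjacency-▷ x i a)))

    blowup-laplacian-◁ : ∀ x j b → (x ◁ L̂) (combine j b) ≈ x (combine j b) * p j - (blockSum k x ◁ A) j
    blowup-laplacian-◁ x j b =
      trans (laplacian-◁ Γ̂ x (combine j b)) (+-cong (*-congˡ (blowup-outdeg j b)) (-‿cong (blowup-adjacency-◁ x j b)))

    sumF-blowup-▷ : ∀ x → sumF N (L̂ ▷ x) ≈ fromℕ k * sumF n (L ▷ blockSum k x)
    sumF-blowup-▷ x = begin
      sumF N (L̂ ▷ x)
        ≈⟨ sumF-combine n k _ ⟩
      sumF n (λ i → sumF k (λ a → (L̂ ▷ x) (combine i a)))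
        ≈⟨ sumF-cong n (λ i → trans (sumF-cong k (blowup-laplacian-▷ x i)) (sumF-sub k _ _)) ⟩
      sumF n (λ i → sumF k (λ a → x (combine i a) * p i) - sumF k (λ _ → (A ▷ blockSum k x) i))
        ≈⟨ sumF-cong n (λ i → +-cong (sumF-*ʳ k _ (p i)) (-‿cong (sumF-const k _))) ⟩
      sumF n (λ i → blockSum k x i * p i - fromℕ k * (A ▷ blockSum k x) i)
        ≈⟨ sumF-cong n (λ i → solve 4 (λ u K d a → u :* (K :* d) :- K :* a := K :* (u :* d :- a)) refl (blockSum k x i) (fromℕ k) (d i) _) ⟩
      sumF n (λ i → fromℕ k * (blockSum k x i * d i - (A ▷ blockSum k x) i))
        ≈⟨ sumF-*ˡ n (fromℕ k) _ ⟩
      fromℕ k * sumF n (λ i → blockSum k x i * d i - (A ▷ blockSum k x) i)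
        ≈⟨ *-congˡ (sym (sumF-cong n (laplacian-▷ Γ (blockSum k x)))) ⟩
      fromℕ k * sumF n (L ▷ blockSum k x) ∎

    private
      blockDot : Vector N → Vector N → Vector n
      blockDot x y j = sumF k (λ b → x (combine j b) * y (combine j b))

      blockTerm : Vector N → Vector N → Carrier → Carrier → Fin n → Carrier
      blockTerm x y α β j =
        (((p j * p j) * blockDot x y j - (p j * α) * blockSum k y j) - (p j * β) * blockSum k x j) + fromℕ k * (α * β)

      dot-blockAffine : ∀ {f g : Vector N} x y (α β : Vector n) →
        (∀ j b → f (combine j b) ≈ x (combine j b) * p j - α j) →
        (∀ j b → g (combine j b) ≈ y (combine j b) * p j - β j) →
        dot f g ≈ sumF n (λ j → blockTerm x y (α j) (β j) j)
      dot-blockAffine x y α β f≈ g≈ = trans (sumF-combine n k _) (sumF-cong n (λ j →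
        trans (sumF-cong k (λ b → *-cong (f≈ j b) (g≈ j b)))
              (sumF-affine-product k (λ b → x (combine j b)) (λ b → y (combine j b)) (p j) (α j) (β j))))

    -- The two Gram terms share the contribution of the diagonal part kD ⊗ I, which cancels.
    commutatorForm-blowup : ∀ x y → commutatorForm L̂ x y ≈ fromℕ k * commutatorForm L (blockSum k x) (blockSum k y)
    commutatorForm-blowup x y = begin
      dot (x ◁ L̂) (y ◁ L̂) - dot (L̂ ▷ x) (L̂ ▷ y)
        ≈⟨ +-cong (dot-blockAffine x y (u ◁ A) (v ◁ A) (blowup-laplacian-◁ x) (blowup-laplacian-◁ y))
                  (-‿cong (dot-blockAffine x y (A ▷ u) (A ▷ v) (blowup-laplacian-▷ x) (blowup-laplacian-▷ y))) ⟩
      sumF n (λ j → blockTerm x y ((u ◁ A) j) ((v ◁ A) j) j) - sumF n (λ j → blockTerm x y ((A ▷ u) j) ((A ▷ v) j) j)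
        ≈⟨ sym (sumF-sub n _ _) ⟩
      sumF n (λ j → blockTerm x y ((u ◁ A) j) ((v ◁ A) j) j - blockTerm x y ((A ▷ u) j) ((A ▷ v) j) j)
        ≈⟨ sumF-cong n (λ j → solve 9 (λ K d S u v a b g e →
             ((((K :* d) :* (K :* d)) :* S :- ((K :* d) :* a) :* v) :- ((K :* d) :* b) :* u) :+ K :* (a :* b)
             :- (((((K :* d) :* (K :* d)) :* S :- ((K :* d) :* g) :* v) :- ((K :* d) :* e) :* u) :+ K :* (g :* e))
             := K :* ((u :* d :- a) :* (v :* d :- b) :- (u :* d :- g) :* (v :* d :- e)))
             refl (fromℕ k) (d j) (blockDot x y j) (u j) (v j) ((u ◁ A) j) ((v ◁ A) j) ((A ▷ u) j) ((A ▷ v) j)) ⟩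
      sumF n (λ j → fromℕ k * (reduced◁ j - reduced▷ j))
        ≈⟨ trans (sumF-*ˡ n (fromℕ k) _) (*-congˡ (sumF-sub n _ _)) ⟩
      fromℕ k * (sumF n reduced◁ - sumF n reduced▷)
        ≈⟨ *-congˡ (sym (+-cong (dot-cong (laplacian-◁ Γ u) (laplacian-◁ Γ v)) (-‿cong (dot-cong (laplacian-▷ Γ u) (laplacian-▷ Γ v))))) ⟩
      fromℕ k * commutatorForm L u v ∎
      where
      u = blockSum k x
      v = blockSum k y
      reduced◁ reduced▷ : Vector n
      reduced◁ j = (u j * d j - (u ◁ A) j) * (v j * d j - (v ◁ A) j)
      reduced▷ j = (u j * d j - (A ▷ u) j) * (v j * d j - (A ▷ v) j)

  blowup-notNormal : ∀ {n k} (Γ : Digraph n) → ¬ Normal (laplacian Γ) → ¬ Normal (laplacian (blowup Γ (suc k)))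
  blowup-notNormal {n} {k} Γ ¬normal normal̂ = ¬normal λ i j → x-y≈0⇒x≈y (x*y≈0⇒y≈0 (fromℕ-suc≉0 k) (begin
    fromℕ (suc k) * ((L ⊠ (L ᵀ)) i j - ((L ᵀ) ⊠ L) i j)
      ≈⟨ *-congˡ (sym (commutatorForm-I L i j)) ⟩
    fromℕ (suc k) * commutatorForm L (I n i) (I n j)
      ≈⟨ *-congˡ (commutatorForm-cong L (sym ∘ blockSum-I i) (sym ∘ blockSum-I j)) ⟩
    fromℕ (suc k) * commutatorForm L (blockSum (suc k) (e i)) (blockSum (suc k) (e j))
      ≈⟨ sym (commutatorForm-blowup Γ (suc k) (e i) (e j)) ⟩
    commutatorForm L̂ (e i) (e j)
      ≈⟨ commutatorForm-I L̂ (combine i zero) (combine j zero) ⟩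
    (L̂ ⊠ (L̂ ᵀ)) (combine i zero) (combine j zero) - ((L̂ ᵀ) ⊠ L̂) (combine i zero) (combine j zero)
      ≈⟨ x≈y⇒x-y≈0 (normal̂ (combine i zero) (combine j zero)) ⟩
    0# ∎))
    where
    L = laplacian Γ
    L̂ = laplacian (blowup Γ (suc k))
    e : Fin n → Vector (n ℕ.* suc k)
    e i = I (n ℕ.* suc k) (combine i zero)

  restrictedNormal⇒defectForm-sumZero : ∀ {m} (Γ : Digraph (suc m)) → RestrictedNormal Γ →
    ∀ u v → sumF (suc m) u ≈ 0# → sumF (suc m) v ≈ 0# → defectForm (laplacian Γ) u v ≈ 0#
  restrictedNormal⇒defectForm-sumZero {m} Γ (_ , compression-normal) =
    defectForm-columns⇒sumZero (laplacian Γ) Q restrictor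
      (normal⇒defectForm-columns (laplacian Γ) (laplacian-rowSum Γ) Q restrictor (compression-normal Q restrictor))
    where
    Q = proj₁ (helmert m)
    restrictor = proj₂ (helmert m)

  -- The order suc n * suc k of the blow-up reduces to suc (k + n * suc k).
  1/suc-cancel : ∀ n k → fromℕ (suc k) * 1/suc (k ℕ.+ n ℕ.* suc k) ≈ 1/suc n
  1/suc-cancel n k = inverse-unique (begin
    fromℕ (suc n) * (fromℕ (suc k) * 1/suc m)    ≈⟨ sym (*-assoc _ _ _) ⟩
    (fromℕ (suc n) * fromℕ (suc k)) * 1/suc m    ≈⟨ *-congʳ (sym (×1-homo-* (suc n) (suc k))) ⟩
    fromℕ (suc n ℕ.* suc k) * 1/suc m            ≈⟨ *-1/suc m ⟩
    1#                                           ∎) (*-1/suc n)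
    where
    m = k ℕ.+ n ℕ.* suc k

  defectForm-blowup : ∀ {n k} (Γ : Digraph (suc n)) x y →
    defectForm (laplacian (blowup Γ (suc k))) x y ≈
    fromℕ (suc k) * defectForm (laplacian Γ) (blockSum (suc k) x) (blockSum (suc k) y)
  defectForm-blowup {n} {k} Γ x y = begin
    commutatorForm L̂ x y + 1/suc m̂ * (sumF (suc m̂) (L̂ ▷ x) * sumF (suc m̂) (L̂ ▷ y))
      ≈⟨ +-cong (commutatorForm-blowup Γ K x y) (*-congˡ (*-cong (sumF-blowup-▷ Γ K x) (sumF-blowup-▷ Γ K y))) ⟩
    fromℕ K * C + 1/suc m̂ * ((fromℕ K * Eu) * (fromℕ K * Ev))
      ≈⟨ solve 5 (λ K C w a b → K :* C :+ w :* ((K :* a) :* (K :* b)) := K :* (C :+ (K :* w) :* (a :* b)))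
                 refl (fromℕ K) C (1/suc m̂) Eu Ev ⟩
    fromℕ K * (C + (fromℕ K * 1/suc m̂) * (Eu * Ev))
      ≈⟨ *-congˡ (+-congˡ (*-congʳ (1/suc-cancel n k))) ⟩
    fromℕ K * (C + 1/suc n * (Eu * Ev)) ∎
    where
    K = suc k
    m̂ = k ℕ.+ n ℕ.* suc k
    L = laplacian Γ
    L̂ = laplacian (blowup Γ K)
    C = commutatorForm L (blockSum K x) (blockSum K y)
    Eu = sumF (suc n) (L ▷ blockSum K x)
    Ev = sumF (suc n) (L ▷ blockSum K y)

  blowup-restrictedNormal : ∀ {n k} (Γ : Digraph (suc n)) → RestrictedNormal Γ → RestrictedNormal (blowup Γ (suc k))
  blowup-restrictedNormal {n} {k} Γ restrictedNormal@(¬normal , _) =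
    blowup-notNormal Γ ¬normal , λ Q restrictor →
      defectForm-columns⇒normal L̂ (laplacian-rowSum (blowup Γ (suc k))) Q restrictor (defect≈0 Q restrictor)
    where
    N̂ = suc n ℕ.* suc k
    L̂ = laplacian (blowup Γ (suc k))
    defect≈0 : ∀ (Q : Mat N̂ (N̂ ∸ 1)) → IsRestrictor Q → ∀ c d → defectForm L̂ (column Q c) (column Q d) ≈ 0#
    defect≈0 Q restrictor c d = begin
      defectForm L̂ (column Q c) (column Q d)
        ≈⟨ defectForm-blowup Γ (column Q c) (column Q d) ⟩
      fromℕ (suc k) * defectForm (laplacian Γ) (u c) (u d)
        ≈⟨ *-congˡ (restrictedNormal⇒defectForm-sumZero Γ restrictedNormal (u c) (u d) (Σu≈0 c) (Σu≈0 d)) ⟩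
      fromℕ (suc k) * 0#
        ≈⟨ zeroʳ (fromℕ (suc k)) ⟩
      0# ∎
      where
      u : Fin (N̂ ∸ 1) → Vector (suc n)
      u c = blockSum (suc k) (column Q c)
      Σu≈0 : ∀ c → sumF (suc n) (u c) ≈ 0#
      Σu≈0 c = trans (blockSum-sumF {suc n} (suc k) (column Q c)) (restrictor-columnSum Q restrictor c)

open import Data.Nat using (_≤_)

theorem3p13 : ∀ {c ℓ ℓ'} (F : EuclideanField c ℓ ℓ') (n : ℕ) (Γ : Digraph n) (k : ℕ) →
    1 ≤ k → Matrices.RestrictedNormal F Γ →
    Matrices.RestrictedNormal F (blowup Γ k) × (DirectedJoin (blowup Γ k) ⇔ DirectedJoin Γ)
theorem3p13 F zero    Γ k       _         (¬normal , _)    = ⊥-elim (¬normal (λ ()))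
theorem3p13 F (suc n) Γ (suc k) (ℕ.s≤s _) restrictedNormal =
  blowup-restrictedNormal F Γ restrictedNormal , blowup-directedJoin⇔ Γ
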